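{- If $n \ge 4$ then there are $9n-11 + \lfloor\frac{n-3}{4}\rfloor$ smooth arithmetical structures on the graph $\mathcal{P}_{2,n}$. Moreover, there are $17$ smooth structures on $\mathcal{P}_{2,3}$, eight smooth structures on $\mathcal{P}_{2,2}$ and three smooth structures on $\mathcal{P}_{2,1}$.
   Context: An arithmetical structure on a graph $G$ is an assignment to each vertex of a nonnegative integer label such that the set of all labels has gcd $1$ and the label of each vertex divides the sum of the labels of its neighbors, counted with multiplicity. The graph $\mathcal{P}_{2,n}$ has vertices $a_1,a_2,b_1,\ldots,b_n$, a single edge between $a_1$ and $a_2$, a single edge between $b_i$ and $b_{i+1}$ ($1\le i<n$), and two edges between $a_1$ and $b_1$. A structure is smooth if $a_1>a_2$ and $b_1>b_2>\cdots>b_n$. Structures are counted with the two sides distinguished. -}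

module Defs where

open import Data.Nat using (ℕ; zero; suc; _+_; _*_; _>_)
open import Data.Nat.Divisibility using (_∣_)
open import Data.Nat.GCD using (gcd)
open import Data.List using (List; []; _∷_; foldr; length)
open import Data.List.Relation.Unary.Linked using (Linked)
open import Data.List.Relation.Unary.Unique.Propositional using (Unique)
open import Data.List.Membership.Propositional using (_∈_)
open import Data.Vec using (Vec; toList)
open import Data.Product using (Σ; _×_; _,_)
open import Data.Unit using (⊤)
open import Function.Bundles using (_⇔_)
open import Relation.Binary.PropositionalEquality using (_≡_)

-- A labelling of P_{2,n}: (a₁ , a₂ , (b₁ … bₙ)).
Labelling : ℕ → Set
Labelling n = ℕ × ℕ × Vec ℕ n

gcdList : List ℕ → ℕ
gcdList = foldr gcd 0

-- first entry of b (b₁), or 0 if n = 0 (only n ≥ 1 is used).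
head0 : List ℕ → ℕ
head0 []      = 0
head0 (x ∷ _) = x

-- Divisibility conditions along the path b₁ … bₙ, where `l` is the
-- contribution of the left neighbour of the first vertex (for b₁ this is
-- 2·a₁, the double edge a₁–b₁).
pathOK : ℕ → List ℕ → Set
pathOK l []           = ⊤
pathOK l (x ∷ [])     = x ∣ l
pathOK l (x ∷ y ∷ r)  = (x ∣ l + y) × pathOK x (y ∷ r)

IsArithmetical : (n : ℕ) → Labelling n → Set
IsArithmetical n (a₁ , a₂ , b) =
  gcdList (a₁ ∷ a₂ ∷ toList b) ≡ 1
  × (a₁ ∣ a₂ + 2 * head0 (toList b))   -- neighbours of a₁: a₂, b₁ (twice)
  × (a₂ ∣ a₁)                            -- neighbour of a₂: a₁
  × pathOK (2 * a₁) (toList b)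

IsSmooth : (n : ℕ) → Labelling n → Set
IsSmooth n (a₁ , a₂ , b) = a₁ > a₂ × Linked _>_ (toList b)

SmoothArith : (n : ℕ) → Labelling n → Set
SmoothArith n s = IsArithmetical n s × IsSmooth n s

HasExactly : (n : ℕ) → ℕ → Set
HasExactly n c =
  Σ (List (Labelling n)) λ xs →
    Unique xs × (∀ s → (s ∈ xs) ⇔ SmoothArith n s) × length xs ≡ c

-- Write a smooth structure as (a₁, a₂, b₁ … bₙ).  Then a₁ = t·a₂ with t ≥ 2,
-- and a₂ + 2b₁ = e·a₁.  If b₁ = b₂ + 2a₁, deleting b₁ leaves a smooth structure
-- on P_{2,n−1}, and conversely every smooth structure on P_{2,n−1} extends in
-- exactly this way (`extend`).  Otherwise b₁ ≤ 2a₁ ("primitive"), so 1 ≤ e ≤ 4.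
-- A decreasing chain is determined by its first entry and its left neighbour
-- (`chain-unique`); rescaling to a₂ = 2 and using gcd = 1 shows that a
-- primitive structure is determined by (e, t) (`structOf-unique`).  For every
-- such (e, t) we write the structure down explicitly (families by t mod 4,
-- with arithmetic-progression paths) and list them by path length.  Hence the
-- smooth structures of length n are the extensions of those of length n − 1
-- together with the primitive ones of length n (`smooths`); there are 3, 5, 9,
-- 8 primitive ones for n = 1, …, 4 and 9 + [n ≡ 3 mod 4, n ≥ 7] for n ≥ 5,
-- which sums to the stated counts.
module Submission where

open import Defs
open import Data.Nat using (ℕ; zero; suc; _+_; _*_; _∸_; _≤_; _<_; _>_; z≤n; s≤s; NonZero; >-nonZero; _/_; _%_; _≟_)
open import Data.Nat.Properties
open import Data.Nat.Divisibility
open import Data.Nat.DivMod using ([m+kn]%n≡m%n; m/n≡1+[m∸n]/n)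
open import Data.Nat.GCD using (gcd; gcd-greatest; gcd[m,n]∣m; gcd[m,n]∣n; c*gcd[m,n]≡gcd[cm,cn])
open import Data.Nat.Tactic.RingSolver using (solve-∀)
open import Data.List using (List; []; _∷_; map; length; _++_)
open import Data.List.Properties using (map-injective; map-cong; map-id; map-id-local; map-∘; length-map; length-++)
open import Data.List.Relation.Unary.Linked using (Linked; []; [-]; _∷_)
open import Data.List.Relation.Unary.All as All using (All; []; _∷_)
import Data.List.Relation.Unary.All.Properties as All
open import Data.List.Relation.Unary.Any using (here; there)
open import Data.List.Relation.Unary.Unique.Propositional using (Unique)
open import Data.List.Relation.Unary.AllPairs as AllPairs using ([])
import Data.List.Relation.Unary.AllPairs.Properties as AllPairs
import Data.List.Relation.Unary.Unique.Propositional.Properties as Unique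
open import Data.List.Relation.Unary.Unique.DecPropositional _≟_ using (unique?)
open import Data.List.Membership.Propositional using (_∈_)
open import Data.List.Membership.Propositional.Properties using (∈-map⁺; ∈-map⁻; ∈-++⁺ˡ; ∈-++⁺ʳ)
open import Data.Vec using (Vec; toList) renaming ([] to []ᵥ; _∷_ to _∷ᵥ_)
open import Data.Vec.Properties using (length-toList)
open import Data.Product using (Σ; _×_; _,_; proj₁; proj₂)
open import Data.Sum using (_⊎_; inj₁; inj₂)
open import Data.Unit using (tt)
open import Data.Empty using (⊥; ⊥-elim)
open import Function using (_∘_)
open import Function.Bundles using (mk⇔)
open import Relation.Nullary using (¬_; Dec; yes; no; contradiction)
open import Relation.Nullary.Decidable using (from-yes)
open import Relation.Binary.PropositionalEquality

chain-cons : ∀ {l x} xs → x ∣ l + head0 xs → pathOK x xs → pathOK l (x ∷ xs)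
chain-cons {l} {x} [] x∣l _ = subst (x ∣_) (+-identityʳ l) x∣l
chain-cons (_ ∷ _) x∣l+y p = x∣l+y , p

chain-uncons : ∀ {l x} xs → pathOK l (x ∷ xs) → x ∣ l + head0 xs × pathOK x xs
chain-uncons {l} {x} [] x∣l = subst (x ∣_) (sym (+-identityʳ l)) x∣l , tt
chain-uncons (_ ∷ _) p = p

∣-below⇒0 : ∀ {x y} → x ∣ y → y < x → y ≡ 0
∣-below⇒0 {y = zero}  _   _   = refl
∣-below⇒0 {y = suc _} x∣y y<x = contradiction x∣y (>⇒∤ y<x)

-- Residues below x are unique: x ∣ l + y and x ∣ l + y' with y, y' < x force
-- y = y'.  This is why a decreasing chain is determined by its start.
residue-unique-≤ : ∀ {x l y y'} → x ∣ l + y → x ∣ l + y' → y ≤ y' → y' < x → y ≡ y'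
residue-unique-≤ {x} {l} {y} {y'} x∣l+y x∣l+y' y≤y' y'<x =
  ≤-antisym y≤y' (m∸n≡0⇒m≤n (∣-below⇒0 x∣difference (≤-<-trans (m∸n≤m y' y) y'<x)))
  where
    split : l + y' ≡ (l + y) + (y' ∸ y)
    split = trans (cong (l +_) (sym (m+[n∸m]≡n y≤y'))) (sym (+-assoc l y (y' ∸ y)))
    x∣difference : x ∣ y' ∸ y
    x∣difference = ∣m+n∣m⇒∣n (subst (x ∣_) split x∣l+y') x∣l+y

residue-unique : ∀ {x l y y'} → x ∣ l + y → x ∣ l + y' → y < x → y' < x → y ≡ y'
residue-unique {y = y} {y'} d d' y<x y'<x with ≤-total y y'
... | inj₁ y≤y' = residue-unique-≤ d d' y≤y' y'<x
... | inj₂ y'≤y = sym (residue-unique-≤ d' d y'≤y y<x)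

-- The first entry of a decreasing chain with positive left contribution is
-- positive: the last entry divides its positive left neighbour.
chain-head-positive : ∀ {x y} ys → 0 < x → pathOK x (y ∷ ys) → Linked _>_ (y ∷ ys) → 0 < y
chain-head-positive {x} {zero}  [] 0<x 0∣x _ = contradiction (0∣⇒≡0 0∣x) (>⇒≢ 0<x)
chain-head-positive {y = suc _} [] _   _   _ = s≤s z≤n
chain-head-positive (_ ∷ _) _ _ (z<y ∷ _) = ≤-<-trans z≤n z<y

-- A decreasing chain with left contribution l cannot continue below an entry
-- x that already divides l: the next entry would be a multiple of x below x.
chain-stops : ∀ {l x y} ys → x ∣ l → pathOK l (x ∷ y ∷ ys) → Linked _>_ (x ∷ y ∷ ys) → ⊥
chain-stops ys x∣l (x∣l+y , p) (y<x ∷ lin) =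
  contradiction (∣-below⇒0 (∣m+n∣m⇒∣n x∣l+y x∣l) y<x)
                (>⇒≢ (chain-head-positive ys (≤-<-trans z≤n y<x) p lin))

chain-unique : ∀ l x xs ys → pathOK l (x ∷ xs) → pathOK l (x ∷ ys) →
               Linked _>_ (x ∷ xs) → Linked _>_ (x ∷ ys) → xs ≡ ys
chain-unique l x [] [] _ _ _ _ = refl
chain-unique l x [] (y ∷ ys) x∣l q _ ly = ⊥-elim (chain-stops ys x∣l q ly)
chain-unique l x (y ∷ xs) [] p x∣l lx _ = ⊥-elim (chain-stops xs x∣l p lx)
chain-unique l x (y ∷ xs) (y' ∷ ys) (d , p) (d' , q) (y<x ∷ lx) (y'<x ∷ ly)
  with residue-unique d d' y<x y'<x
... | refl = cong (y ∷_) (chain-unique x y xs ys p q lx ly)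

chain-scale : ∀ c l xs → pathOK l xs → pathOK (c * l) (map (c *_) xs)
chain-scale c l [] _ = tt
chain-scale c l (x ∷ []) x∣l = *-monoʳ-∣ c x∣l
chain-scale c l (x ∷ y ∷ xs) (d , p) =
  subst (c * x ∣_) (*-distribˡ-+ c l y) (*-monoʳ-∣ c d) , chain-scale c x (y ∷ xs) p

chain-unscale : ∀ c .{{_ : NonZero c}} l xs → pathOK (c * l) (map (c *_) xs) → pathOK l xs
chain-unscale c l [] _ = tt
chain-unscale c l (x ∷ []) d = *-cancelˡ-∣ c d
chain-unscale c l (x ∷ y ∷ xs) (d , p) =
  *-cancelˡ-∣ c (subst (c * x ∣_) (sym (*-distribˡ-+ c l y)) d) , chain-unscale c x (y ∷ xs) p

decreasing-scale : ∀ c .{{_ : NonZero c}} xs → Linked _>_ xs → Linked _>_ (map (c *_) xs)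
decreasing-scale c [] _ = []
decreasing-scale c (x ∷ []) _ = [-]
decreasing-scale c (x ∷ y ∷ xs) (y<x ∷ l) = *-monoʳ-< c y<x ∷ decreasing-scale c (y ∷ xs) l

decreasing-unscale : ∀ c xs → Linked _>_ (map (c *_) xs) → Linked _>_ xs
decreasing-unscale c [] _ = []
decreasing-unscale c (x ∷ []) _ = [-]
decreasing-unscale c (x ∷ y ∷ xs) (lt ∷ l) = *-cancelˡ-< c y x lt ∷ decreasing-unscale c (y ∷ xs) l

gcdList-greatest : ∀ {d} xs → All (d ∣_) xs → d ∣ gcdList xs
gcdList-greatest {d} [] [] = d ∣0
gcdList-greatest (x ∷ xs) (d∣x ∷ ds) = gcd-greatest d∣x (gcdList-greatest xs ds)

gcdList-divides : ∀ xs → All (gcdList xs ∣_) xs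
gcdList-divides [] = []
gcdList-divides (x ∷ xs) =
  gcd[m,n]∣m x (gcdList xs) ∷ All.map (∣-trans (gcd[m,n]∣n x (gcdList xs))) (gcdList-divides xs)

gcdList-scale : ∀ c xs → gcdList (map (c *_) xs) ≡ c * gcdList xs
gcdList-scale c [] = sym (*-zeroʳ c)
gcdList-scale c (x ∷ xs) =
  trans (cong (gcd (c * x)) (gcdList-scale c xs)) (sym (c*gcd[m,n]≡gcd[cm,cn] c x (gcdList xs)))

gcdList-one : ∀ xs → 1 ∈ xs → gcdList xs ≡ 1
gcdList-one xs 1∈xs = ∣1⇒≡1 (All.lookup (gcdList-divides xs) 1∈xs)

coprime-transfer : ∀ xs ys → gcdList xs ≡ 1 → All (gcdList ys ∣_) xs → gcdList ys ≡ 1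
coprime-transfer xs ys g≡1 divs = ∣1⇒≡1 (subst (gcdList ys ∣_) g≡1 (gcdList-greatest xs divs))

Struct : Set
Struct = ℕ × ℕ × List ℕ

path : Struct → List ℕ
path (_ , _ , bs) = bs

-- Smooth arithmetical structures on list labellings; by definition
-- `SmoothArith n (a₁ , a₂ , b)` is `Smooth (a₁ , a₂ , toList b)`.
Smooth : Struct → Set
Smooth (a₁ , a₂ , bs) =
  (gcdList (a₁ ∷ a₂ ∷ bs) ≡ 1 × (a₁ ∣ a₂ + 2 * head0 bs) × (a₂ ∣ a₁) × pathOK (2 * a₁) bs)
  × (a₁ > a₂ × Linked _>_ bs)

-- a₂ ∣ a₁ and a₂ < a₁ exclude a₁ ∣ a₂ (which would force a₂ = 0 and then a₁ = 0).
no-mutual-divisibility : ∀ {a₁ a₂} → a₂ ∣ a₁ → a₂ < a₁ → ¬ a₁ ∣ a₂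
no-mutual-divisibility {a₁} a₂∣a₁ a₂<a₁ a₁∣a₂ with ∣-below⇒0 a₁∣a₂ a₂<a₁
... | refl = <-irrefl (sym (0∣⇒≡0 a₂∣a₁)) a₂<a₁

no-empty-path : ∀ {a₁ a₂} → ¬ Smooth (a₁ , a₂ , [])
no-empty-path {a₁} {a₂} ((_ , a₁∣a₂+0 , a₂∣a₁ , _) , a₂<a₁ , _) =
  no-mutual-divisibility a₂∣a₁ a₂<a₁ (subst (a₁ ∣_) (+-identityʳ a₂) a₁∣a₂+0)

-- Extension: prepend b₀ = b₁ + 2a₁, i.e. the new first vertex has quotient 1.
extend : Struct → Struct
extend (a₁ , a₂ , bs) = (a₁ , a₂ , (head0 bs + 2 * a₁) ∷ bs)

extend-injective : ∀ {s s'} → extend s ≡ extend s' → s ≡ s'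
extend-injective {_ , _ , _} {_ , _ , _} refl = refl

extend-smooth : ∀ s → Smooth s → Smooth (extend s)
extend-smooth (a₁ , a₂ , []) smooth = ⊥-elim (no-empty-path smooth)
extend-smooth (a₁ , a₂ , b ∷ bs) ((g≡1 , a₁∣ , a₂∣a₁ , chain) , a₂<a₁ , decreasing) =
  (coprime , a₁∣' , a₂∣a₁ , chain-cons (b ∷ bs) (divides 1 top) (chain-cons bs b∣ (proj₂ rest)))
  , a₂<a₁ , b<b₀ ∷ decreasing
  where
    b₀ : ℕ
    b₀ = b + 2 * a₁
    rest : b ∣ 2 * a₁ + head0 bs × pathOK b bs
    rest = chain-uncons bs chain
    coprime : gcdList (a₁ ∷ a₂ ∷ b₀ ∷ b ∷ bs) ≡ 1
    coprime = coprime-transfer (a₁ ∷ a₂ ∷ b ∷ bs) (a₁ ∷ a₂ ∷ b₀ ∷ b ∷ bs) g≡1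
      (drop-b₀ (gcdList-divides (a₁ ∷ a₂ ∷ b₀ ∷ b ∷ bs)))
      where drop-b₀ : ∀ {d} → All (d ∣_) (a₁ ∷ a₂ ∷ b₀ ∷ b ∷ bs) → All (d ∣_) (a₁ ∷ a₂ ∷ b ∷ bs)
            drop-b₀ (d₁ ∷ d₂ ∷ _ ∷ ds) = d₁ ∷ d₂ ∷ ds
    a₁∣' : a₁ ∣ a₂ + 2 * b₀
    a₁∣' = subst (a₁ ∣_) (shift a₂ b a₁) (∣m∣n⇒∣m+n a₁∣ (divides 4 refl))
      where shift : ∀ a₂ b a₁ → a₂ + 2 * b + 4 * a₁ ≡ a₂ + 2 * (b + 2 * a₁)
            shift = solve-∀
    top : 2 * a₁ + b ≡ 1 * b₀
    top = trans (+-comm (2 * a₁) b) (sym (*-identityˡ b₀))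
    b∣ : b ∣ b₀ + head0 bs
    b∣ = subst (b ∣_) (sym (+-assoc b (2 * a₁) (head0 bs))) (∣m∣n⇒∣m+n ∣-refl (proj₁ rest))
    b<b₀ : b < b₀
    b<b₀ = m<m+n b (*-monoʳ-< 2 (≤-<-trans z≤n a₂<a₁))

reduce-smooth : ∀ a₁ a₂ b₁ b₂ bs → Smooth (a₁ , a₂ , b₁ ∷ b₂ ∷ bs) → b₁ ≡ b₂ + 2 * a₁ →
                Smooth (a₁ , a₂ , b₂ ∷ bs)
reduce-smooth a₁ a₂ b₁ b₂ bs ((g≡1 , a₁∣ , a₂∣a₁ , (_ , chain)) , a₂<a₁ , (_ ∷ decreasing)) refl =
  (coprime , a₁∣' , a₂∣a₁ , chain-cons bs b₂∣ (proj₂ rest)) , a₂<a₁ , decreasing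
  where
    rest : b₂ ∣ b₁ + head0 bs × pathOK b₂ bs
    rest = chain-uncons bs chain
    coprime : gcdList (a₁ ∷ a₂ ∷ b₂ ∷ bs) ≡ 1
    coprime = coprime-transfer (a₁ ∷ a₂ ∷ b₁ ∷ b₂ ∷ bs) (a₁ ∷ a₂ ∷ b₂ ∷ bs) g≡1
      (add-b₁ (gcdList-divides (a₁ ∷ a₂ ∷ b₂ ∷ bs)))
      where add-b₁ : ∀ {d} → All (d ∣_) (a₁ ∷ a₂ ∷ b₂ ∷ bs) → All (d ∣_) (a₁ ∷ a₂ ∷ b₁ ∷ b₂ ∷ bs)
            add-b₁ (d₁ ∷ d₂ ∷ d₃ ∷ ds) = d₁ ∷ d₂ ∷ ∣m∣n⇒∣m+n d₃ (∣n⇒∣m*n 2 d₁) ∷ d₃ ∷ ds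
    a₁∣' : a₁ ∣ a₂ + 2 * b₂
    a₁∣' = ∣m+n∣m⇒∣n (subst (a₁ ∣_) (shift a₂ b₂ a₁) a₁∣) (divides 4 refl)
      where shift : ∀ a₂ b a₁ → a₂ + 2 * (b + 2 * a₁) ≡ 4 * a₁ + (a₂ + 2 * b)
            shift = solve-∀
    b₂∣ : b₂ ∣ 2 * a₁ + head0 bs
    b₂∣ = ∣m+n∣m⇒∣n (subst (b₂ ∣_) (+-assoc b₂ (2 * a₁) (head0 bs)) (proj₁ rest)) ∣-refl

-- Unless b₁ = b₂ + 2a₁, the first entry satisfies b₁ ≤ 2a₁: the quotient
-- (2a₁ + b₂)/b₁ is then at least 2.  Such structures are called primitive.
single-entry-bound : ∀ a₁ a₂ b₁ → Smooth (a₁ , a₂ , b₁ ∷ []) → b₁ ≤ 2 * a₁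
single-entry-bound (suc a₁) a₂ b₁ ((_ , _ , _ , b₁∣2a₁) , _ , _) = ∣⇒≤ b₁∣2a₁

non-extension-bound : ∀ a₁ a₂ b₁ b₂ bs → Smooth (a₁ , a₂ , b₁ ∷ b₂ ∷ bs) → b₁ ≢ b₂ + 2 * a₁ →
                      b₁ ≤ 2 * a₁
non-extension-bound a₁ a₂ b₁ b₂ bs ((_ , _ , _ , (divides k 2a₁+b₂≡k*b₁ , _)) , a₂<a₁ , (b₂<b₁ ∷ _)) b₁≢ =
  by-quotient k 2a₁+b₂≡k*b₁
  where
    by-quotient : ∀ k → 2 * a₁ + b₂ ≡ k * b₁ → b₁ ≤ 2 * a₁
    by-quotient zero eq = contradiction (m+n≡0⇒m≡0 (2 * a₁) eq) (>⇒≢ (*-monoʳ-< 2 (≤-<-trans z≤n a₂<a₁)))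
    by-quotient (suc zero) eq = contradiction (sym (trans (+-comm b₂ (2 * a₁)) (trans eq (+-identityʳ b₁)))) b₁≢
    by-quotient (suc (suc k)) eq = <⇒≤ (+-cancelʳ-< b₁ b₁ (2 * a₁) (begin-strict
      b₁ + b₁              ≤⟨ m≤m+n (b₁ + b₁) (k * b₁) ⟩
      b₁ + b₁ + k * b₁     ≡⟨ +-assoc b₁ b₁ (k * b₁) ⟩
      suc (suc k) * b₁     ≡⟨ sym eq ⟩
      2 * a₁ + b₂          <⟨ +-monoʳ-< (2 * a₁) b₂<b₁ ⟩
      2 * a₁ + b₁          ∎))
      where open ≤-Reasoning

HasParameters : Struct → ℕ → ℕ → Set
HasParameters (a₁ , a₂ , bs) t e = a₁ ≡ t * a₂ × a₂ + 2 * head0 bs ≡ e * a₁ × 0 < a₂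

below-multiple : ∀ {a₁ a₂ t} → a₁ ≡ t * a₂ → 0 < a₂ → 2 ≤ t → a₂ < a₁
below-multiple {a₂ = a₂} {t} a₁≡ 0<a₂ 2≤t =
  subst (a₂ <_) (trans (*-comm a₂ t) (sym a₁≡)) (m<m*n a₂ t {{>-nonZero 0<a₂}} 2≤t)

parameters-unique : ∀ s {t t' e e'} → 2 ≤ t → HasParameters s t e → HasParameters s t' e' →
                    t ≡ t' × e ≡ e'
parameters-unique (a₁ , a₂ , bs) {t} {t'} {e} {e'} 2≤t (a₁≡ , eb , 0<a₂) (a₁≡' , eb' , _) =
  *-cancelʳ-≡ t t' a₂ {{>-nonZero 0<a₂}} (trans (sym a₁≡) a₁≡') ,
  *-cancelʳ-≡ e e' a₁ {{>-nonZero (≤-<-trans z≤n (below-multiple a₁≡ 0<a₂ 2≤t))}} (trans (sym eb) eb')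

-- A primitive structure (b₁ ≤ 2a₁) has parameters 2 ≤ t and 1 ≤ e ≤ 4, since
-- e·a₁ = a₂ + 2b₁ < a₁ + 4a₁.
primitive-parameters : ∀ a₁ a₂ b₁ bs → Smooth (a₁ , a₂ , b₁ ∷ bs) → b₁ ≤ 2 * a₁ →
  Σ ℕ λ t → Σ ℕ λ e → HasParameters (a₁ , a₂ , b₁ ∷ bs) t e × 2 ≤ t × 1 ≤ e × e ≤ 4
primitive-parameters a₁ a₂ b₁ bs ((_ , divides e eb , divides t a₁≡ , _) , a₂<a₁ , _) b₁≤2a₁ =
  t , e , (a₁≡ , eb , 0<a₂) , 2≤t t a₁≡ , 1≤e e eb , e≤4
  where
    0<a₂ : 0 < a₂
    0<a₂ = n≢0⇒n>0 λ a₂≡0 →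
      >⇒≢ a₂<a₁ (trans a₁≡ (trans (cong (t *_) a₂≡0) (trans (*-zeroʳ t) (sym a₂≡0))))
    2≤t : ∀ t → a₁ ≡ t * a₂ → 2 ≤ t
    2≤t zero          a₁≡0  = contradiction a₁≡0 (>⇒≢ (≤-<-trans z≤n a₂<a₁))
    2≤t (suc zero)    a₁≡a₂ = contradiction (trans a₁≡a₂ (*-identityˡ a₂)) (>⇒≢ a₂<a₁)
    2≤t (suc (suc _)) _     = s≤s (s≤s z≤n)
    1≤e : ∀ e → a₂ + 2 * b₁ ≡ e * a₁ → 1 ≤ e
    1≤e zero    eb = contradiction (m+n≡0⇒m≡0 a₂ eb) (>⇒≢ 0<a₂)
    1≤e (suc _) _  = s≤s z≤n
    e≤4 : e ≤ 4
    e≤4 = ≤-pred (*-cancelʳ-< a₁ e 5 (begin-strict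
      e * a₁               ≡⟨ sym eb ⟩
      a₂ + 2 * b₁          <⟨ +-monoˡ-< (2 * b₁) a₂<a₁ ⟩
      a₁ + 2 * b₁          ≤⟨ +-monoʳ-≤ a₁ (*-monoʳ-≤ 2 b₁≤2a₁) ⟩
      a₁ + 2 * (2 * a₁)    ≡⟨ five a₁ ⟩
      5 * a₁               ∎))
      where open ≤-Reasoning
            five : ∀ a → a + 2 * (2 * a) ≡ 5 * a
            five = solve-∀

FirstEntryLarge : Struct → Set
FirstEntryLarge (a₁ , _ , bs) = 2 * a₁ ≤ head0 bs

extension-large : ∀ s → FirstEntryLarge (extend s)
extension-large (a₁ , _ , bs) = m≤n+m (2 * a₁) (head0 bs)

parameters-not-large : ∀ s {t e} → HasParameters s t e → e ≤ 4 → ¬ FirstEntryLarge s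
parameters-not-large (a₁ , a₂ , bs) {e = e} (_ , eb , 0<a₂) e≤4 =
  <⇒≱ (*-cancelˡ-< 2 (head0 bs) (2 * a₁) (begin-strict
    2 * head0 bs         <⟨ m<n+m (2 * head0 bs) 0<a₂ ⟩
    a₂ + 2 * head0 bs    ≡⟨ eb ⟩
    e * a₁               ≤⟨ *-monoˡ-≤ a₁ e≤4 ⟩
    4 * a₁               ≡⟨ four a₁ ⟩
    2 * (2 * a₁)         ∎))
  where open ≤-Reasoning
        four : ∀ a → 4 * a ≡ 2 * (2 * a)
        four = solve-∀

-- A chain rescaled to a₂ = 2 either contains 1 (so the structure really has
-- a₂ = 2) or is twice a chain (so the structure has a₂ = 1).
data Parity (D : List ℕ) : Set where
  contains-one : 1 ∈ D → Parity D
  doubled      : (H : List ℕ) → D ≡ map (2 *_) H → Parity D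

-- Tags distinguishing the primitive structures of a fixed length: within one
-- length, different structures have different (e, t mod 4).
keyOf : ℕ → ℕ → ℕ
keyOf 1 r = r
keyOf 2 _ = 8
keyOf 3 r = 4 + r
keyOf 4 _ = 9
keyOf _ _ = 10

-- An explicit primitive structure with parameters (t, e), given by its path
-- rescaled to a₂ = 2: a decreasing chain with left contribution 2a₁ = 4t and
-- first entry e·t − 1.
record Primitive : Set where
  constructor mkPrimitive
  field
    t e        : ℕ
    2≤t        : 2 ≤ t
    e≤4        : e ≤ 4
    chain      : List ℕ
    chain-ok   : pathOK (4 * t) chain
    decreasing : Linked _>_ chain
    chain-head : head0 chain + 1 ≡ e * t
    parity     : Parity chain
    key        : ℕ
    key-ok     : key ≡ keyOf e (t % 4)

structOf : Primitive → Struct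
structOf (mkPrimitive t _ _ _ D _ _ _ (contains-one _) _ _) = (t * 2 , 2 , D)
structOf (mkPrimitive t _ _ _ _ _ _ _ (doubled H _) _ _)    = (t , 1 , H)

head-double : ∀ H → head0 (map (2 *_) H) ≡ 2 * head0 H
head-double []      = refl
head-double (_ ∷ _) = refl

structOf-parameters : ∀ F → HasParameters (structOf F) (Primitive.t F) (Primitive.e F)
structOf-parameters (mkPrimitive t e _ _ D _ _ D₁+1≡et (contains-one _) _ _) = refl , eb , s≤s z≤n
  where
    open ≡-Reasoning
    eb : 2 + 2 * head0 D ≡ e * (t * 2)
    eb = begin
      2 + 2 * head0 D    ≡⟨ factor (head0 D) ⟩
      2 * (head0 D + 1)  ≡⟨ cong (2 *_) D₁+1≡et ⟩
      2 * (e * t)        ≡⟨ rearrange e t ⟩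
      e * (t * 2)        ∎
      where factor : ∀ d → 2 + 2 * d ≡ 2 * (d + 1)
            factor = solve-∀
            rearrange : ∀ e t → 2 * (e * t) ≡ e * (t * 2)
            rearrange = solve-∀
structOf-parameters (mkPrimitive t e _ _ _ _ _ D₁+1≡et (doubled H refl) _ _) =
  sym (*-identityʳ t) , eb , s≤s z≤n
  where
    eb : 1 + 2 * head0 H ≡ e * t
    eb = trans (+-comm 1 (2 * head0 H)) (trans (cong (_+ 1) (sym (head-double H))) D₁+1≡et)

-- The explicit structures are smooth: the gcd is 1 because of the entry 1
-- (either a₂ = 1 or 1 ∈ D), and the chain conditions are those of D.
structOf-smooth : ∀ F → Smooth (structOf F)
structOf-smooth F@(mkPrimitive t e 2≤t _ D chain-ok decreasing _ (contains-one 1∈D) _ _)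
  with (a₁≡ , eb , 0<a₂) ← structOf-parameters F =
  (gcdList-one (t * 2 ∷ 2 ∷ D) (there (there 1∈D)) , divides e eb , divides t a₁≡ ,
   subst (λ l → pathOK l D) (four t) chain-ok) , below-multiple a₁≡ 0<a₂ 2≤t , decreasing
  where
    four : ∀ t → 4 * t ≡ 2 * (t * 2)
    four = solve-∀
structOf-smooth F@(mkPrimitive t e 2≤t _ _ chain-ok decreasing _ (doubled H refl) _ _)
  with (a₁≡ , eb , 0<a₂) ← structOf-parameters F =
  (gcdList-one (t ∷ 1 ∷ H) (there (here refl)) , divides e eb , divides t a₁≡ ,
   chain-unscale 2 (2 * t) H (subst (λ l → pathOK l (map (2 *_) H)) (four t) chain-ok)) ,
  below-multiple a₁≡ 0<a₂ 2≤t , decreasing-unscale 2 H decreasing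
  where
    four : ∀ t → 4 * t ≡ 2 * (2 * t)
    four = solve-∀

scale-by-one : ∀ xs → map (1 *_) xs ≡ xs
scale-by-one xs = trans (map-cong *-identityˡ xs) (map-id xs)

double-injective : ∀ {xs ys} → map (2 *_) xs ≡ map (2 *_) ys → xs ≡ ys
double-injective = map-injective (*-cancelˡ-≡ _ _ 2)

one-not-doubled : ∀ xs → ¬ 1 ∈ map (2 *_) xs
one-not-doubled xs 1∈2xs with ∈-map⁻ (2 *_) {xs = xs} 1∈2xs
... | x , _ , 1≡2x = contradiction (∣1⇒≡1 (divides x (trans 1≡2x (*-comm 2 x)))) (λ ())

all-multiples : ∀ a xs → All (a ∣_) (map (a *_) xs)
all-multiples a [] = []
all-multiples a (x ∷ xs) = divides x (*-comm a x) ∷ all-multiples a xs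

rescaled-path : ∀ {t e} a₁ a₂ b₁ bs d D →
                Smooth (a₁ , a₂ , b₁ ∷ bs) → HasParameters (a₁ , a₂ , b₁ ∷ bs) t e →
                pathOK (4 * t) (d ∷ D) → Linked _>_ (d ∷ D) → d + 1 ≡ e * t →
                map (2 *_) (b₁ ∷ bs) ≡ map (a₂ *_) (d ∷ D)
rescaled-path {t} {e} a₁ a₂ b₁ bs d D ((_ , _ , _ , b-ok) , _ , b-dec) (a₁≡ , eb , 0<a₂) D-ok D-dec d+1≡et =
  cong₂ _∷_ 2b₁≡a₂d (chain-unique (2 * (2 * a₁)) (2 * b₁) _ _ 2b-ok a₂D-ok 2b-dec a₂D-dec)
  where
    open ≡-Reasoning
    2b₁≡a₂d : 2 * b₁ ≡ a₂ * d
    2b₁≡a₂d = +-cancelˡ-≡ a₂ (2 * b₁) (a₂ * d) (begin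
      a₂ + 2 * b₁     ≡⟨ eb ⟩
      e * a₁          ≡⟨ cong (e *_) a₁≡ ⟩
      e * (t * a₂)    ≡⟨ *-assoc e t a₂ ⟨
      (e * t) * a₂    ≡⟨ cong (_* a₂) d+1≡et ⟨
      (d + 1) * a₂    ≡⟨ expand d a₂ ⟩
      a₂ + a₂ * d     ∎)
      where expand : ∀ d a → (d + 1) * a ≡ a + a * d
            expand = solve-∀
    4a₁≡ : 2 * (2 * a₁) ≡ a₂ * (4 * t)
    4a₁≡ = trans (cong (λ a → 2 * (2 * a)) a₁≡) (rearrange t a₂)
      where rearrange : ∀ t a → 2 * (2 * (t * a)) ≡ a * (4 * t)
            rearrange = solve-∀
    2b-ok : pathOK (2 * (2 * a₁)) (2 * b₁ ∷ map (2 *_) bs)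
    2b-ok = chain-scale 2 (2 * a₁) (b₁ ∷ bs) b-ok
    a₂D-ok : pathOK (2 * (2 * a₁)) (2 * b₁ ∷ map (a₂ *_) D)
    a₂D-ok = subst₂ (λ l x → pathOK l (x ∷ map (a₂ *_) D)) (sym 4a₁≡) (sym 2b₁≡a₂d)
                    (chain-scale a₂ (4 * t) (d ∷ D) D-ok)
    2b-dec : Linked _>_ (2 * b₁ ∷ map (2 *_) bs)
    2b-dec = decreasing-scale 2 (b₁ ∷ bs) b-dec
    a₂D-dec : Linked _>_ (2 * b₁ ∷ map (a₂ *_) D)
    a₂D-dec = subst (λ x → Linked _>_ (x ∷ map (a₂ *_) D)) (sym 2b₁≡a₂d)
                    (decreasing-scale a₂ {{>-nonZero 0<a₂}} (d ∷ D) D-dec)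

a₂∣2 : ∀ {t} a₁ a₂ bs D → gcdList (a₁ ∷ a₂ ∷ bs) ≡ 1 → a₁ ≡ t * a₂ →
       map (2 *_) bs ≡ map (a₂ *_) D → a₂ ∣ 2
a₂∣2 {t} a₁ a₂ bs D g≡1 a₁≡ 2b≡a₂D =
  subst (a₂ ∣_) (trans (gcdList-scale 2 (a₁ ∷ a₂ ∷ bs)) (cong (2 *_) g≡1)) (gcdList-greatest _ multiples)
  where
    multiples : All (a₂ ∣_) (2 * a₁ ∷ 2 * a₂ ∷ map (2 *_) bs)
    multiples = divides (2 * t) (trans (cong (2 *_) a₁≡) (sym (*-assoc 2 t a₂)))
              ∷ divides 2 refl ∷ subst (All (a₂ ∣_)) (sym 2b≡a₂D) (all-multiples a₂ D)

one-or-two : ∀ {a} → 0 < a → a ∣ 2 → a ≡ 1 ⊎ a ≡ 2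
one-or-two {1} _ _ = inj₁ refl
one-or-two {2} _ _ = inj₂ refl
one-or-two {suc (suc (suc _))} _ a∣2 with ∣⇒≤ a∣2
... | s≤s (s≤s ())

-- Matching a₂ ∈ {1, 2} against the parity of the chain of F: the mixed cases
-- contradict 1 ∈ D resp. gcd = 1, the others give exactly structOf F.
identify : ∀ {a₁ a₂ bs} F → a₂ ≡ 1 ⊎ a₂ ≡ 2 → map (2 *_) bs ≡ map (a₂ *_) (Primitive.chain F) →
           gcdList (a₁ ∷ a₂ ∷ bs) ≡ 1 → a₁ ≡ Primitive.t F * a₂ → (a₁ , a₂ , bs) ≡ structOf F
identify {bs = bs} (mkPrimitive _ _ _ _ D _ _ _ (contains-one 1∈D) _ _) (inj₁ refl) 2b≡D _ _ =
  ⊥-elim (one-not-doubled bs (subst (1 ∈_) (sym (trans 2b≡D (scale-by-one D))) 1∈D))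
identify (mkPrimitive _ _ _ _ _ _ _ _ (contains-one _) _ _) (inj₂ refl) 2b≡2D _ a₁≡ =
  cong₂ (λ a b → (a , 2 , b)) a₁≡ (double-injective 2b≡2D)
identify (mkPrimitive t _ _ _ _ _ _ _ (doubled H refl) _ _) (inj₁ refl) 2b≡2H _ a₁≡ =
  cong₂ (λ a b → (a , 1 , b)) (trans a₁≡ (*-identityʳ t)) (double-injective (trans 2b≡2H (scale-by-one _)))
identify {a₁} {bs = bs} (mkPrimitive t _ _ _ _ _ _ _ (doubled H refl) _ _) (inj₂ refl) 2b≡4H g≡1 a₁≡ =
  contradiction (∣1⇒≡1 (subst (2 ∣_) g≡1 (gcdList-greatest _ all-even))) (λ ())
  where
    all-even : All (2 ∣_) (a₁ ∷ 2 ∷ bs)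
    all-even = divides t a₁≡ ∷ divides 1 refl
             ∷ subst (All (2 ∣_)) (sym (double-injective 2b≡4H)) (all-multiples 2 H)

structOf-unique : ∀ F a₁ a₂ bs → Smooth (a₁ , a₂ , bs) →
                  HasParameters (a₁ , a₂ , bs) (Primitive.t F) (Primitive.e F) → (a₁ , a₂ , bs) ≡ structOf F
structOf-unique (mkPrimitive t e 2≤t _ [] _ _ 1≡et _ _ _) _ _ _ _ _ =
  contradiction (m*n≡1⇒n≡1 e t (sym 1≡et)) (>⇒≢ 2≤t)
structOf-unique F a₁ a₂ [] smooth _ = ⊥-elim (no-empty-path smooth)
structOf-unique F@(mkPrimitive t e _ _ (d ∷ D) D-ok D-dec d+1≡et _ _ _) a₁ a₂ (b₁ ∷ bs)
                smooth@((g≡1 , _) , _) params@(a₁≡ , _ , 0<a₂) =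
  identify F (one-or-two 0<a₂ (a₂∣2 {t} a₁ a₂ (b₁ ∷ bs) (d ∷ D) g≡1 a₁≡ 2b≡a₂D)) 2b≡a₂D g≡1 a₁≡
  where
    2b≡a₂D : map (2 *_) (b₁ ∷ bs) ≡ map (a₂ *_) (d ∷ D)
    2b≡a₂D = rescaled-path {t} {e} a₁ a₂ b₁ bs d D smooth params D-ok D-dec d+1≡et

-- Equal structures come from primitives with equal parameters, hence equal keys.
key-determined : ∀ F G → structOf F ≡ structOf G → Primitive.key F ≡ Primitive.key G
key-determined F G eq =
  trans (Primitive.key-ok F) (trans (cong₂ (λ t e → keyOf e (t % 4)) (proj₁ same) (proj₂ same))
                                    (sym (Primitive.key-ok G)))
  where
    same : Primitive.t F ≡ Primitive.t G × Primitive.e F ≡ Primitive.e G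
    same = parameters-unique (structOf F) {Primitive.t F} {Primitive.t G} {Primitive.e F} {Primitive.e G}
             (Primitive.2≤t F) (structOf-parameters F)
             (subst (λ s → HasParameters s (Primitive.t G) (Primitive.e G)) (sym eq) (structOf-parameters G))

progression : ℕ → ℕ → ℕ → List ℕ → List ℕ
progression c d zero    rest = rest
progression c d (suc k) rest = (k * d + c) ∷ progression c d k rest

-- Inner entries of a progression have quotient 2, so a progression is a chain
-- as soon as its bottom and its top fit.
progression-chain : ∀ c d rest k → pathOK (1 * d + c) (c ∷ rest) →
                    pathOK (suc k * d + c) (progression c d (suc k) rest)
progression-chain c d rest zero bottom = bottom
progression-chain c d rest (suc k) bottom =
  chain-cons {suc (suc k) * d + c} (progression c d (suc k) rest) (divides 2 (middle k d c)) (progression-chain c d rest k bottom)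
  where middle : ∀ k d c → suc (suc k) * d + c + (k * d + c) ≡ 2 * (suc k * d + c)
        middle = solve-∀

progression-chain-top : ∀ c d rest L k → (suc k * d + c) ∣ L + (k * d + c) →
                        pathOK (1 * d + c) (c ∷ rest) → pathOK L (progression c d (suc (suc k)) rest)
progression-chain-top c d rest L k top bottom =
  chain-cons {L} (progression c d (suc k) rest) top (progression-chain c d rest k bottom)

progression-decreasing : ∀ c d rest k → 0 < d → Linked _>_ (c ∷ rest) →
                         Linked _>_ (progression c d (suc k) rest)
progression-decreasing c d rest zero    _   dec = dec
progression-decreasing c d rest (suc k) 0<d dec =
  step ∷ progression-decreasing c d rest k 0<d dec
  where step : k * d + c < suc k * d + c
        step = +-monoˡ-< c (subst (k * d <_) (+-comm (k * d) d) (m<m+n (k * d) 0<d))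

progression-length : ∀ c d k rest → length (progression c d k rest) ≡ k + length rest
progression-length c d zero    rest = refl
progression-length c d (suc k) rest = cong suc (progression-length c d k rest)

progression-double : ∀ c d k rest → map (2 *_) (progression c d k rest) ≡ progression (2 * c) (2 * d) k (map (2 *_) rest)
progression-double c d zero    rest = refl
progression-double c d (suc k) rest = cong₂ _∷_ (distribute k d c) (progression-double c d k rest)
  where distribute : ∀ k d c → 2 * (k * d + c) ≡ k * (2 * d) + 2 * c
        distribute = solve-∀

progression-∋-rest : ∀ {x} c d k rest → x ∈ rest → x ∈ progression c d k rest
progression-∋-rest c d zero    rest x∈ = x∈
progression-∋-rest c d (suc k) rest x∈ = there (progression-∋-rest c d k rest x∈)

progression-∋-last : ∀ c d k rest → c ∈ progression c d (suc k) rest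
progression-∋-last c d zero    rest = here refl
progression-∋-last c d (suc k) rest = there (progression-∋-last c d k rest)

<-from-gap : ∀ {m n} k → suc m + k ≡ n → m < n
<-from-gap {m} k eq = subst (suc m ≤_) eq (m≤m+n (suc m) k)

residue-key : ∀ e r q → keyOf e (r % 4) ≡ keyOf e ((r + q * 4) % 4)
residue-key e r q = cong (keyOf e) (sym ([m+kn]%n≡m%n r q 4))

-- The explicit primitive structures.  `e1-tr q` has e = 1 and t = r + 4q,
-- `e3-tr q` has e = 3 and t = r + 4q; `e2 p` and `e4 p` have t = 2 + p.
-- Each chain is a progression, possibly below two larger entries.
e1-t2 : ℕ → Primitive
e1-t2 q = mkPrimitive (2 + q * 4) 1 (s≤s (s≤s z≤n)) (s≤s z≤n) (progression 1 4 (suc q) [])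
  (ok q) (progression-decreasing 1 4 _ q (s≤s z≤n) [-]) (head q)
  (contains-one (progression-∋-last 1 4 q [])) 2 (residue-key 1 2 q)
  where
    ok : ∀ q → pathOK (4 * (2 + q * 4)) (progression 1 4 (suc q) [])
    ok zero = divides 8 refl
    ok (suc q) = progression-chain-top 1 4 _ (4 * (2 + suc q * 4)) q (divides 5 (top q)) (divides 5 refl)
      where top : ∀ q → 4 * (2 + suc q * 4) + (q * 4 + 1) ≡ 5 * (suc q * 4 + 1)
            top = solve-∀
    head : ∀ q → q * 4 + 1 + 1 ≡ 1 * (2 + q * 4)
    head = solve-∀

e1-t3 : ℕ → Primitive
e1-t3 q = mkPrimitive (3 + q * 4) 1 (s≤s (s≤s z≤n)) (s≤s z≤n) (progression 2 4 (suc q) [])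
  (ok q) (progression-decreasing 2 4 _ q (s≤s z≤n) [-]) (head q)
  (doubled (progression 1 2 (suc q) []) (sym (progression-double 1 2 (suc q) []))) 3 (residue-key 1 3 q)
  where
    ok : ∀ q → pathOK (4 * (3 + q * 4)) (progression 2 4 (suc q) [])
    ok zero = divides 6 refl
    ok (suc q) = progression-chain-top 2 4 _ (4 * (3 + suc q * 4)) q (divides 5 (top q)) (divides 3 refl)
      where top : ∀ q → 4 * (3 + suc q * 4) + (q * 4 + 2) ≡ 5 * (suc q * 4 + 2)
            top = solve-∀
    head : ∀ q → q * 4 + 2 + 1 ≡ 1 * (3 + q * 4)
    head = solve-∀

e1-t4 : ℕ → Primitive
e1-t4 q = mkPrimitive (4 + q * 4) 1 (s≤s (s≤s z≤n)) (s≤s z≤n) (progression 3 4 (suc q) (2 ∷ 1 ∷ []))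
  (ok q) (progression-decreasing 3 4 _ q (s≤s z≤n) (≤-refl ∷ ≤-refl ∷ [-])) (head q)
  (contains-one (progression-∋-rest 3 4 (suc q) _ (there (here refl)))) 0 (residue-key 1 4 q)
  where
    ok : ∀ q → pathOK (4 * (4 + q * 4)) (progression 3 4 (suc q) (2 ∷ 1 ∷ []))
    ok zero = divides 6 refl , divides 2 refl , divides 2 refl
    ok (suc q) = progression-chain-top 3 4 _ (4 * (4 + suc q * 4)) q (divides 5 (top q))
                   (divides 3 refl , divides 2 refl , divides 2 refl)
      where top : ∀ q → 4 * (4 + suc q * 4) + (q * 4 + 3) ≡ 5 * (suc q * 4 + 3)
            top = solve-∀
    head : ∀ q → q * 4 + 3 + 1 ≡ 1 * (4 + q * 4)
    head = solve-∀

e1-t5 : ℕ → Primitive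
e1-t5 q = mkPrimitive (5 + q * 4) 1 (s≤s (s≤s z≤n)) (s≤s z≤n) (progression 4 4 (suc q) [])
  (ok q) (progression-decreasing 4 4 _ q (s≤s z≤n) [-]) (head q)
  (doubled (progression 2 2 (suc q) []) (sym (progression-double 2 2 (suc q) []))) 1 (residue-key 1 5 q)
  where
    ok : ∀ q → pathOK (4 * (5 + q * 4)) (progression 4 4 (suc q) [])
    ok zero = divides 5 refl
    ok (suc q) = progression-chain-top 4 4 _ (4 * (5 + suc q * 4)) q (divides 5 (top q)) (divides 2 refl)
      where top : ∀ q → 4 * (5 + suc q * 4) + (q * 4 + 4) ≡ 5 * (suc q * 4 + 4)
            top = solve-∀
    head : ∀ q → q * 4 + 4 + 1 ≡ 1 * (5 + q * 4)
    head = solve-∀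

e2 : ℕ → Primitive
e2 p = mkPrimitive (2 + p) 2 (s≤s (s≤s z≤n)) (s≤s (s≤s z≤n)) (progression 1 2 (suc (suc p)) [])
  (progression-chain-top 1 2 [] (4 * (2 + p)) p (divides 3 (top p)) (divides 3 refl))
  (progression-decreasing 1 2 _ (suc p) (s≤s z≤n) [-]) (head p)
  (contains-one (progression-∋-last 1 2 (suc p) [])) 8 refl
  where
    top : ∀ p → 4 * (2 + p) + (p * 2 + 1) ≡ 3 * (suc p * 2 + 1)
    top = solve-∀
    head : ∀ p → suc p * 2 + 1 + 1 ≡ 2 * (2 + p)
    head = solve-∀

e3-t2 : Primitive
e3-t2 = mkPrimitive 2 3 (s≤s (s≤s z≤n)) (s≤s (s≤s (s≤s z≤n))) (5 ∷ 2 ∷ 1 ∷ [])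
  (divides 2 refl , divides 3 refl , divides 2 refl) (s≤s (s≤s (s≤s z≤n)) ∷ ≤-refl ∷ [-]) refl
  (contains-one (there (there (here refl)))) 6 refl

e3-t3 : ℕ → Primitive
e3-t3 q = mkPrimitive (3 + q * 4) 3 (s≤s (s≤s z≤n)) (s≤s (s≤s (s≤s z≤n)))
  ((8 + q * 12) ∷ (4 + q * 8) ∷ progression 4 4 q [])
  (divides 2 (top q) , ok q) (<-from-gap (3 + q * 4) (gap q) ∷ dec q) (head q)
  (doubled ((4 + q * 6) ∷ (2 + q * 4) ∷ progression 2 2 q [])
     (cong₂ _∷_ (halve₁ q) (cong₂ _∷_ (halve₂ q) (sym (progression-double 2 2 q [])))))
  7 (residue-key 3 3 q)
  where
    top : ∀ q → 4 * (3 + q * 4) + (4 + q * 8) ≡ 2 * (8 + q * 12)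
    top = solve-∀
    gap : ∀ q → suc (4 + q * 8) + (3 + q * 4) ≡ 8 + q * 12
    gap = solve-∀
    halve₁ : ∀ q → 8 + q * 12 ≡ 2 * (4 + q * 6)
    halve₁ = solve-∀
    halve₂ : ∀ q → 4 + q * 8 ≡ 2 * (2 + q * 4)
    halve₂ = solve-∀
    ok : ∀ q → pathOK (8 + q * 12) ((4 + q * 8) ∷ progression 4 4 q [])
    ok zero = divides 2 refl
    ok (suc zero) = divides 2 refl , divides 3 refl
    ok (suc (suc q)) = divides 2 (second q) ,
      progression-chain-top 4 4 _ (4 + suc (suc q) * 8) q (divides 3 (third q)) (divides 2 refl)
      where second : ∀ q → 8 + suc (suc q) * 12 + (suc q * 4 + 4) ≡ 2 * (4 + suc (suc q) * 8)
            second = solve-∀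
            third : ∀ q → 4 + suc (suc q) * 8 + (q * 4 + 4) ≡ 3 * (suc q * 4 + 4)
            third = solve-∀
    dec : ∀ q → Linked _>_ ((4 + q * 8) ∷ progression 4 4 q [])
    dec zero = [-]
    dec (suc q) = <-from-gap (7 + q * 4) (gap′ q) ∷ progression-decreasing 4 4 [] q (s≤s z≤n) [-]
      where gap′ : ∀ q → suc (q * 4 + 4) + (7 + q * 4) ≡ 4 + suc q * 8
            gap′ = solve-∀
    head : ∀ q → 8 + q * 12 + 1 ≡ 3 * (3 + q * 4)
    head = solve-∀

e3-t4 : ℕ → Primitive
e3-t4 q = mkPrimitive (4 + q * 4) 3 (s≤s (s≤s z≤n)) (s≤s (s≤s (s≤s z≤n)))
  ((11 + q * 12) ∷ (6 + q * 8) ∷ progression 1 4 (suc q) [])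
  (divides 2 (top₁ q) , divides 2 (top₂ q) , ok q)
  (<-from-gap (4 + q * 4) (gap₁ q) ∷ <-from-gap (4 + q * 4) (gap₂ q) ∷ progression-decreasing 1 4 _ q (s≤s z≤n) [-])
  (head q) (contains-one (there (there (progression-∋-last 1 4 q [])))) 4 (residue-key 3 4 q)
  where
    top₁ : ∀ q → 4 * (4 + q * 4) + (6 + q * 8) ≡ 2 * (11 + q * 12)
    top₁ = solve-∀
    top₂ : ∀ q → 11 + q * 12 + (q * 4 + 1) ≡ 2 * (6 + q * 8)
    top₂ = solve-∀
    gap₁ : ∀ q → suc (6 + q * 8) + (4 + q * 4) ≡ 11 + q * 12
    gap₁ = solve-∀
    gap₂ : ∀ q → suc (q * 4 + 1) + (4 + q * 4) ≡ 6 + q * 8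
    gap₂ = solve-∀
    ok : ∀ q → pathOK (6 + q * 8) (progression 1 4 (suc q) [])
    ok zero = divides 6 refl
    ok (suc q) = progression-chain-top 1 4 _ (6 + suc q * 8) q (divides 3 (top q)) (divides 5 refl)
      where top : ∀ q → 6 + suc q * 8 + (q * 4 + 1) ≡ 3 * (suc q * 4 + 1)
            top = solve-∀
    head : ∀ q → 11 + q * 12 + 1 ≡ 3 * (4 + q * 4)
    head = solve-∀

e3-t5 : ℕ → Primitive
e3-t5 q = mkPrimitive (5 + q * 4) 3 (s≤s (s≤s z≤n)) (s≤s (s≤s (s≤s z≤n)))
  ((14 + q * 12) ∷ (8 + q * 8) ∷ progression 2 4 (suc q) [])
  (divides 2 (top₁ q) , divides 2 (top₂ q) , ok q)
  (<-from-gap (5 + q * 4) (gap₁ q) ∷ <-from-gap (5 + q * 4) (gap₂ q) ∷ progression-decreasing 2 4 _ q (s≤s z≤n) [-])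
  (head q)
  (doubled ((7 + q * 6) ∷ (4 + q * 4) ∷ progression 1 2 (suc q) [])
     (cong₂ _∷_ (halve₁ q) (cong₂ _∷_ (halve₂ q) (sym (progression-double 1 2 (suc q) [])))))
  5 (residue-key 3 5 q)
  where
    top₁ : ∀ q → 4 * (5 + q * 4) + (8 + q * 8) ≡ 2 * (14 + q * 12)
    top₁ = solve-∀
    top₂ : ∀ q → 14 + q * 12 + (q * 4 + 2) ≡ 2 * (8 + q * 8)
    top₂ = solve-∀
    gap₁ : ∀ q → suc (8 + q * 8) + (5 + q * 4) ≡ 14 + q * 12
    gap₁ = solve-∀
    gap₂ : ∀ q → suc (q * 4 + 2) + (5 + q * 4) ≡ 8 + q * 8
    gap₂ = solve-∀
    halve₁ : ∀ q → 14 + q * 12 ≡ 2 * (7 + q * 6)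
    halve₁ = solve-∀
    halve₂ : ∀ q → 8 + q * 8 ≡ 2 * (4 + q * 4)
    halve₂ = solve-∀
    ok : ∀ q → pathOK (8 + q * 8) (progression 2 4 (suc q) [])
    ok zero = divides 4 refl
    ok (suc q) = progression-chain-top 2 4 _ (8 + suc q * 8) q (divides 3 (top q)) (divides 3 refl)
      where top : ∀ q → 8 + suc q * 8 + (q * 4 + 2) ≡ 3 * (suc q * 4 + 2)
            top = solve-∀
    head : ∀ q → 14 + q * 12 + 1 ≡ 3 * (5 + q * 4)
    head = solve-∀

e3-t6 : ℕ → Primitive
e3-t6 q = mkPrimitive (6 + q * 4) 3 (s≤s (s≤s z≤n)) (s≤s (s≤s (s≤s z≤n)))
  ((17 + q * 12) ∷ (10 + q * 8) ∷ progression 3 4 (suc q) (2 ∷ 1 ∷ []))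
  (divides 2 (top₁ q) , divides 2 (top₂ q) , ok q)
  (<-from-gap (6 + q * 4) (gap₁ q) ∷ <-from-gap (6 + q * 4) (gap₂ q)
     ∷ progression-decreasing 3 4 _ q (s≤s z≤n) (≤-refl ∷ ≤-refl ∷ [-]))
  (head q) (contains-one (there (there (progression-∋-rest 3 4 (suc q) _ (there (here refl))))))
  6 (residue-key 3 6 q)
  where
    top₁ : ∀ q → 4 * (6 + q * 4) + (10 + q * 8) ≡ 2 * (17 + q * 12)
    top₁ = solve-∀
    top₂ : ∀ q → 17 + q * 12 + (q * 4 + 3) ≡ 2 * (10 + q * 8)
    top₂ = solve-∀
    gap₁ : ∀ q → suc (10 + q * 8) + (6 + q * 4) ≡ 17 + q * 12
    gap₁ = solve-∀
    gap₂ : ∀ q → suc (q * 4 + 3) + (6 + q * 4) ≡ 10 + q * 8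
    gap₂ = solve-∀
    ok : ∀ q → pathOK (10 + q * 8) (progression 3 4 (suc q) (2 ∷ 1 ∷ []))
    ok zero = divides 4 refl , divides 2 refl , divides 2 refl
    ok (suc q) = progression-chain-top 3 4 _ (10 + suc q * 8) q (divides 3 (top q))
                   (divides 3 refl , divides 2 refl , divides 2 refl)
      where top : ∀ q → 10 + suc q * 8 + (q * 4 + 3) ≡ 3 * (suc q * 4 + 3)
            top = solve-∀
    head : ∀ q → 17 + q * 12 + 1 ≡ 3 * (6 + q * 4)
    head = solve-∀

e4 : ℕ → Primitive
e4 p = mkPrimitive (2 + p) 4 (s≤s (s≤s z≤n)) ≤-refl (progression 1 1 (7 + p * 4) [])
  (progression-chain-top 1 1 [] (4 * (2 + p)) (5 + p * 4) (divides 2 (top p)) (divides 2 refl))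
  (progression-decreasing 1 1 _ (6 + p * 4) (s≤s z≤n) [-]) (head p)
  (contains-one (progression-∋-last 1 1 (6 + p * 4) [])) 9 refl
  where
    top : ∀ p → 4 * (2 + p) + ((5 + p * 4) * 1 + 1) ≡ 2 * (suc (5 + p * 4) * 1 + 1)
    top = solve-∀
    head : ∀ p → (6 + p * 4) * 1 + 1 + 1 ≡ 4 * (2 + p)
    head = solve-∀

size : Primitive → ℕ
size F = length (Primitive.chain F)

path-length : ∀ F → length (path (structOf F)) ≡ size F
path-length (mkPrimitive _ _ _ _ _ _ _ _ (contains-one _) _ _) = refl
path-length (mkPrimitive _ _ _ _ _ _ _ _ (doubled H refl) _ _) = sym (length-map (2 *_) H)

progression-size : ∀ c d k → length (progression c d k []) ≡ k
progression-size c d k = trans (progression-length c d k []) (+-identityʳ k)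

progression-size₂ : ∀ c d k → length (progression c d (suc k) (2 ∷ 1 ∷ [])) ≡ 3 + k
progression-size₂ c d k = trans (progression-length c d (suc k) _) (+-comm (suc k) 2)

e1-t2-size : ∀ q → size (e1-t2 q) ≡ 1 + q
e1-t2-size q = progression-size 1 4 (suc q)

e1-t3-size : ∀ q → size (e1-t3 q) ≡ 1 + q
e1-t3-size q = progression-size 2 4 (suc q)

e1-t4-size : ∀ q → size (e1-t4 q) ≡ 3 + q
e1-t4-size q = progression-size₂ 3 4 q

e1-t5-size : ∀ q → size (e1-t5 q) ≡ 1 + q
e1-t5-size q = progression-size 4 4 (suc q)

e2-size : ∀ p → size (e2 p) ≡ 2 + p
e2-size p = progression-size 1 2 (2 + p)

e3-t3-size : ∀ q → size (e3-t3 q) ≡ 2 + q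
e3-t3-size q = cong (2 +_) (progression-size 4 4 q)

e3-t4-size : ∀ q → size (e3-t4 q) ≡ 3 + q
e3-t4-size q = cong (2 +_) (progression-size 1 4 (suc q))

e3-t5-size : ∀ q → size (e3-t5 q) ≡ 3 + q
e3-t5-size q = cong (2 +_) (progression-size 2 4 (suc q))

e3-t6-size : ∀ q → size (e3-t6 q) ≡ 5 + q
e3-t6-size q = cong (2 +_) (progression-size₂ 3 4 q)

e4-size : ∀ p → size (e4 p) ≡ 7 + p * 4
e4-size p = progression-size 1 1 (7 + p * 4)

-- The primitive structures of path length n, built in layers so that every
-- family sits at a fixed position:
--   primitives₄ p k  : the structure with e = 4 of length 5 + k + 4p (k = 2 only),
--   sporadic k       : the remaining ones of length 3 + k (e = 3, t = 2 or 6 + 4q; e = 4),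
--   primitives₃ k    : those of length 2 + k present from length 3 on,
--   primitives₂ k    : those of length 1 + k present from length 2 on,
--   primitives n     : all of length n.
primitives₄ : ℕ → ℕ → List Primitive
primitives₄ p 0 = []
primitives₄ p 1 = []
primitives₄ p 2 = e4 p ∷ []
primitives₄ p 3 = []
primitives₄ p (suc (suc (suc (suc k)))) = primitives₄ (suc p) k

sporadic : ℕ → List Primitive
sporadic zero          = e3-t2 ∷ []
sporadic (suc zero)    = []
sporadic (suc (suc k)) = e3-t6 k ∷ primitives₄ 0 k

primitives₃ : ℕ → List Primitive
primitives₃ zero    = []
primitives₃ (suc k) = e1-t4 k ∷ e3-t4 k ∷ e3-t5 k ∷ sporadic k

primitives₂ : ℕ → List Primitive
primitives₂ zero    = []
primitives₂ (suc k) = e2 k ∷ e3-t3 k ∷ primitives₃ k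

primitives : ℕ → List Primitive
primitives zero    = []
primitives (suc k) = e1-t2 k ∷ e1-t3 k ∷ e1-t5 k ∷ primitives₂ k

primitives₄-size : ∀ p k → All (λ F → size F ≡ 5 + k + p * 4) (primitives₄ p k)
primitives₄-size p 0 = []
primitives₄-size p 1 = []
primitives₄-size p 2 = e4-size p ∷ []
primitives₄-size p 3 = []
primitives₄-size p (suc (suc (suc (suc k)))) =
  All.map (λ eq → trans eq (shift k p)) (primitives₄-size (suc p) k)
  where shift : ∀ k p → 5 + k + suc p * 4 ≡ 5 + (4 + k) + p * 4
        shift = solve-∀

sporadic-size : ∀ k → All (λ F → size F ≡ 3 + k) (sporadic k)
sporadic-size zero          = refl ∷ []
sporadic-size (suc zero)    = []
sporadic-size (suc (suc k)) =
  e3-t6-size k ∷ All.map (λ eq → trans eq (+-identityʳ (5 + k))) (primitives₄-size 0 k)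

primitives₃-size : ∀ k → All (λ F → size F ≡ 2 + k) (primitives₃ k)
primitives₃-size zero    = []
primitives₃-size (suc k) = e1-t4-size k ∷ e3-t4-size k ∷ e3-t5-size k ∷ sporadic-size k

primitives₂-size : ∀ k → All (λ F → size F ≡ 1 + k) (primitives₂ k)
primitives₂-size zero    = []
primitives₂-size (suc k) = e2-size k ∷ e3-t3-size k ∷ primitives₃-size k

primitives-size : ∀ n → All (λ F → size F ≡ n) (primitives n)
primitives-size zero    = []
primitives-size (suc k) = e1-t2-size k ∷ e1-t3-size k ∷ e1-t5-size k ∷ primitives₂-size k

-- Passing between the layers.  The index k is explicit: inferring it would make
-- the type checker unfold and compare the explicit structures themselves.
∈primitives₂ : ∀ {F} k → F ∈ primitives₂ k → F ∈ primitives (suc k)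
∈primitives₂ _ F∈ = there (there (there F∈))

∈primitives₃ : ∀ {F} k → F ∈ primitives₃ k → F ∈ primitives₂ (suc k)
∈primitives₃ _ F∈ = there (there F∈)

∈sporadic : ∀ {F} k → F ∈ sporadic k → F ∈ primitives₃ (suc k)
∈sporadic _ F∈ = there (there (there F∈))

e4-listed : ∀ p a → e4 (p + a) ∈ primitives₄ a (2 + p * 4)
e4-listed zero    a = here refl
e4-listed (suc p) a = subst (λ q → e4 q ∈ primitives₄ a (2 + suc p * 4)) (+-suc p a) (e4-listed p (suc a))

data Residue4 : ℕ → Set where
  r0 : ∀ q → Residue4 (q * 4)
  r1 : ∀ q → Residue4 (1 + q * 4)
  r2 : ∀ q → Residue4 (2 + q * 4)
  r3 : ∀ q → Residue4 (3 + q * 4)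

residue4 : ∀ u → Residue4 u
residue4 zero = r0 0
residue4 (suc u) with residue4 u
... | r0 q = r1 q
... | r1 q = r2 q
... | r2 q = r3 q
... | r3 q = r0 (suc q)

Realised : ℕ → ℕ → Set
Realised e t = Σ Primitive λ F → Primitive.t F ≡ t × Primitive.e F ≡ e × F ∈ primitives (size F)

listed : ∀ F n → size F ≡ n → F ∈ primitives n → Realised (Primitive.e F) (Primitive.t F)
listed F n size≡n F∈ = F , refl , refl , subst (λ m → F ∈ primitives m) (sym size≡n) F∈

realise : ∀ e t → 1 ≤ e → e ≤ 4 → 2 ≤ t → Realised e t
realise 1 (suc (suc u)) _ _ _ with residue4 u
... | r0 q = listed (e1-t2 q) (1 + q) (e1-t2-size q) (here refl)
... | r1 q = listed (e1-t3 q) (1 + q) (e1-t3-size q) (there (here refl))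
... | r2 q = listed (e1-t4 q) (3 + q) (e1-t4-size q) (∈primitives₂ (2 + q) (∈primitives₃ (1 + q) (here refl)))
... | r3 q = listed (e1-t5 q) (1 + q) (e1-t5-size q) (there (there (here refl)))
realise 2 (suc (suc u)) _ _ _ = listed (e2 u) (2 + u) (e2-size u) (∈primitives₂ (1 + u) (here refl))
realise 3 2 _ _ _ = listed e3-t2 3 refl (∈primitives₂ 2 (∈primitives₃ 1 (∈sporadic 0 (here refl))))
realise 3 (suc (suc (suc v))) _ _ _ with residue4 v
... | r0 q = listed (e3-t3 q) (2 + q) (e3-t3-size q) (∈primitives₂ (1 + q) (there (here refl)))
... | r1 q = listed (e3-t4 q) (3 + q) (e3-t4-size q)
                    (∈primitives₂ (2 + q) (∈primitives₃ (1 + q) (there (here refl))))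
... | r2 q = listed (e3-t5 q) (3 + q) (e3-t5-size q)
                    (∈primitives₂ (2 + q) (∈primitives₃ (1 + q) (there (there (here refl)))))
... | r3 q = listed (e3-t6 q) (5 + q) (e3-t6-size q)
                    (∈primitives₂ (4 + q) (∈primitives₃ (3 + q) (∈sporadic (2 + q) (here refl))))
realise 4 (suc (suc u)) _ _ _ = listed (e4 u) (7 + u * 4) (e4-size u)
  (∈primitives₂ (6 + u * 4) (∈primitives₃ (5 + u * 4) (∈sporadic (4 + u * 4)
    (there (subst (λ p → e4 p ∈ primitives₄ 0 (2 + u * 4)) (+-identityʳ u) (e4-listed u 0))))))
realise 0 _ () _ _
realise (suc (suc (suc (suc (suc _))))) _ _ (s≤s (s≤s (s≤s (s≤s ())))) _
realise _ 0 _ _ ()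
realise _ 1 _ _ (s≤s ())

realised-listed : ∀ {t e} a₁ a₂ bs → Smooth (a₁ , a₂ , bs) → HasParameters (a₁ , a₂ , bs) t e →
                  Realised e t → (a₁ , a₂ , bs) ∈ map structOf (primitives (length bs))
realised-listed a₁ a₂ bs smooth params (F , refl , refl , F∈) =
  subst₂ (λ s n → s ∈ map structOf (primitives n)) (sym s≡F) size≡ (∈-map⁺ structOf F∈)
  where
    s≡F : (a₁ , a₂ , bs) ≡ structOf F
    s≡F = structOf-unique F a₁ a₂ bs smooth params
    size≡ : size F ≡ length bs
    size≡ = trans (sym (path-length F)) (cong (λ s → length (path s)) (sym s≡F))

primitive-listed : ∀ a₁ a₂ b₁ bs → Smooth (a₁ , a₂ , b₁ ∷ bs) → b₁ ≤ 2 * a₁ →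
                   (a₁ , a₂ , b₁ ∷ bs) ∈ map structOf (primitives (suc (length bs)))
primitive-listed a₁ a₂ b₁ bs smooth b₁≤2a₁ with primitive-parameters a₁ a₂ b₁ bs smooth b₁≤2a₁
... | t , e , params , 2≤t , 1≤e , e≤4 =
  realised-listed a₁ a₂ (b₁ ∷ bs) smooth params (realise e t 1≤e e≤4 2≤t)

-- Keys of the listed structures are pairwise distinct, hence so are the structures.
primitives₄-keys : ∀ p k → map Primitive.key (primitives₄ p k) ≡ [] ⊎ map Primitive.key (primitives₄ p k) ≡ 9 ∷ []
primitives₄-keys p 0 = inj₁ refl
primitives₄-keys p 1 = inj₁ refl
primitives₄-keys p 2 = inj₂ refl
primitives₄-keys p 3 = inj₁ refl
primitives₄-keys p (suc (suc (suc (suc k)))) = primitives₄-keys (suc p) k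

keys-unique : ∀ n → Unique (map Primitive.key (primitives n))
keys-unique 0 = []
keys-unique 1 = from-yes (unique? (2 ∷ 3 ∷ 1 ∷ []))
keys-unique 2 = from-yes (unique? (2 ∷ 3 ∷ 1 ∷ 8 ∷ 7 ∷ []))
keys-unique 3 = from-yes (unique? (2 ∷ 3 ∷ 1 ∷ 8 ∷ 7 ∷ 0 ∷ 4 ∷ 5 ∷ 6 ∷ []))
keys-unique 4 = from-yes (unique? (2 ∷ 3 ∷ 1 ∷ 8 ∷ 7 ∷ 0 ∷ 4 ∷ 5 ∷ []))
keys-unique (suc (suc (suc (suc (suc k))))) with map Primitive.key (primitives₄ 0 k) | primitives₄-keys 0 k
... | _ | inj₁ refl = from-yes (unique? (2 ∷ 3 ∷ 1 ∷ 8 ∷ 7 ∷ 0 ∷ 4 ∷ 5 ∷ 6 ∷ []))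
... | _ | inj₂ refl = from-yes (unique? (2 ∷ 3 ∷ 1 ∷ 8 ∷ 7 ∷ 0 ∷ 4 ∷ 5 ∷ 6 ∷ 9 ∷ []))

listed-unique : ∀ n → Unique (map structOf (primitives n))
listed-unique n =
  AllPairs.map⁺ {R = _≢_} {f = structOf}
    (AllPairs.map {R = λ F G → Primitive.key F ≢ Primitive.key G} {S = λ F G → structOf F ≢ structOf G}
                  (λ {F} {G} keys≢ → keys≢ ∘ key-determined F G)
                  (AllPairs.map⁻ {R = _≢_} {f = Primitive.key} (keys-unique n)))

-- Hence an extension is never primitive.
primitive-not-large : ∀ F → ¬ FirstEntryLarge (structOf F)
primitive-not-large F =
  parameters-not-large (structOf F) {Primitive.t F} {Primitive.e F} (structOf-parameters F) (Primitive.e≤4 F)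

smooths : ℕ → List Struct
smooths zero    = []
smooths (suc n) = map extend (smooths n) ++ map structOf (primitives (suc n))

smooths-sound : ∀ n → All (λ s → Smooth s × length (path s) ≡ n) (smooths n)
smooths-sound zero    = []
smooths-sound (suc n) =
  All.++⁺ (All.map⁺ (All.map (λ {s} (smooth , len) → extend-smooth s smooth , cong suc len) (smooths-sound n)))
          (All.map⁺ (All.map (λ {F} size≡ → structOf-smooth F , trans (path-length F) size≡) (primitives-size (suc n))))

smooths-complete : ∀ a₁ a₂ bs → Smooth (a₁ , a₂ , bs) → (a₁ , a₂ , bs) ∈ smooths (length bs)
smooths-complete a₁ a₂ [] smooth = ⊥-elim (no-empty-path smooth)
smooths-complete a₁ a₂ (b₁ ∷ []) smooth =
  ∈-++⁺ʳ (map extend (smooths 0)) (primitive-listed a₁ a₂ b₁ [] smooth (single-entry-bound a₁ a₂ b₁ smooth))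
smooths-complete a₁ a₂ (b₁ ∷ bs@(b₂ ∷ bs′)) smooth =
  by-first-entry (b₁ ≟ b₂ + 2 * a₁) (λ b₁≡ → smooths-complete a₁ a₂ bs (reduce-smooth a₁ a₂ b₁ b₂ bs′ smooth b₁≡))
  where
    by-first-entry : Dec (b₁ ≡ b₂ + 2 * a₁) → (b₁ ≡ b₂ + 2 * a₁ → (a₁ , a₂ , bs) ∈ smooths (length bs)) →
                     (a₁ , a₂ , b₁ ∷ bs) ∈ smooths (suc (length bs))
    by-first-entry (yes b₁≡) shorter =
      ∈-++⁺ˡ (subst (_∈ map extend (smooths (length bs))) (cong (λ b → (a₁ , a₂ , b ∷ bs)) (sym b₁≡))
                    (∈-map⁺ extend (shorter b₁≡)))
    by-first-entry (no b₁≢) _ =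
      ∈-++⁺ʳ (map extend (smooths (length bs)))
             (primitive-listed a₁ a₂ b₁ bs smooth (non-extension-bound a₁ a₂ b₁ b₂ bs′ smooth b₁≢))

smooths-unique : ∀ n → Unique (smooths n)
smooths-unique zero    = []
smooths-unique (suc n) =
  Unique.++⁺ (Unique.map⁺ extend-injective (smooths-unique n)) (listed-unique (suc n)) disjoint
  where
    disjoint : ∀ {s} → ¬ (s ∈ map extend (smooths n) × s ∈ map structOf (primitives (suc n)))
    disjoint (s∈extensions , s∈primitives) =
      All.lookup (All.map⁺ {P = ¬_ ∘ FirstEntryLarge} (All.universal primitive-not-large (primitives (suc n))))
                 s∈primitives
                 (All.lookup (All.map⁺ {P = FirstEntryLarge} (All.universal extension-large (smooths n))) s∈extensions)

smooths-count : ∀ n → length (smooths (suc n)) ≡ length (smooths n) + length (primitives (suc n))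
smooths-count n = trans (length-++ (map extend (smooths n)))
  (cong₂ _+_ (length-map extend (smooths n)) (length-map structOf (primitives (suc n))))

-- The structures with e = 4 contribute the term ⌊(n − 3)/4⌋.
primitives₄-count : ∀ p k → (2 + k) / 4 ≡ (1 + k) / 4 + length (primitives₄ p k)
primitives₄-count p 0 = refl
primitives₄-count p 1 = refl
primitives₄-count p 2 = refl
primitives₄-count p 3 = refl
primitives₄-count p (suc (suc (suc (suc k)))) = begin
  (6 + k) / 4                                      ≡⟨ m/n≡1+[m∸n]/n {6 + k} {4} (s≤s (s≤s (s≤s (s≤s z≤n)))) ⟩
  1 + (2 + k) / 4                                  ≡⟨ cong suc (primitives₄-count (suc p) k) ⟩
  1 + ((1 + k) / 4 + length (primitives₄ (suc p) k)) ≡⟨ cong (_+ length (primitives₄ (suc p) k))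
                                                        (m/n≡1+[m∸n]/n {5 + k} {4} (s≤s (s≤s (s≤s (s≤s z≤n))))) ⟨
  (5 + k) / 4 + length (primitives₄ (suc p) k)     ∎
  where open ≡-Reasoning

-- From length 5 on, 9 + |primitives₄ 0 k| new structures appear at length 5 + k.
count : ∀ k → length (smooths (4 + k)) ≡ 25 + 9 * k + (1 + k) / 4
count zero    = refl
count (suc k) = begin
  length (smooths (5 + k))                                ≡⟨ smooths-count (4 + k) ⟩
  length (smooths (4 + k)) + (9 + new)                    ≡⟨ cong (_+ (9 + new)) (count k) ⟩
  25 + 9 * k + (1 + k) / 4 + (9 + new)                    ≡⟨ regroup k ((1 + k) / 4) new ⟩
  25 + 9 * suc k + ((1 + k) / 4 + new)                    ≡⟨ cong (25 + 9 * suc k +_) (primitives₄-count 0 k) ⟨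
  25 + 9 * suc k + (2 + k) / 4                            ∎
  where
    open ≡-Reasoning
    new : ℕ
    new = length (primitives₄ 0 k)
    regroup : ∀ k q m → 25 + 9 * k + q + (9 + m) ≡ 25 + 9 * suc k + (q + m)
    regroup = solve-∀

-- A list read as a vector of length n (padded with zeros or truncated).
vecOf : (n : ℕ) → List ℕ → Vec ℕ n
vecOf zero    _        = []ᵥ
vecOf (suc n) []       = 0 ∷ᵥ vecOf n []
vecOf (suc n) (x ∷ xs) = x ∷ᵥ vecOf n xs

toList-vecOf : ∀ n xs → length xs ≡ n → toList (vecOf n xs) ≡ xs
toList-vecOf zero    []       _  = refl
toList-vecOf (suc n) (x ∷ xs) eq = cong (x ∷_) (toList-vecOf n xs (suc-injective eq))

vecOf-toList : ∀ {n} (v : Vec ℕ n) → vecOf n (toList v) ≡ v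
vecOf-toList []ᵥ       = refl
vecOf-toList (x ∷ᵥ v) = cong (x ∷ᵥ_) (vecOf-toList v)

toLabelling : (n : ℕ) → Struct → Labelling n
toLabelling n (a₁ , a₂ , bs) = (a₁ , a₂ , vecOf n bs)

toStruct : ∀ {n} → Labelling n → Struct
toStruct (a₁ , a₂ , b) = (a₁ , a₂ , toList b)

exactly : ∀ n xs → Unique xs → All (λ s → Smooth s × length (path s) ≡ n) xs →
          (∀ a₁ a₂ (b : Vec ℕ n) → Smooth (a₁ , a₂ , toList b) → (a₁ , a₂ , toList b) ∈ xs) →
          HasExactly n (length xs)
exactly n xs unique sound complete =
  map (toLabelling n) xs , unique′ , (λ s → mk⇔ (listed⇒smooth s) (smooth⇒listed s)) , length-map (toLabelling n) xs
  where
    round-trip : ∀ {s} → s ∈ xs → toStruct (toLabelling n s) ≡ s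
    round-trip {a₁ , a₂ , bs} s∈ = cong (λ b → (a₁ , a₂ , b)) (toList-vecOf n bs (proj₂ (All.lookup sound s∈)))
    unique′ : Unique (map (toLabelling n) xs)
    unique′ = Unique.map⁻ {f = toStruct} (subst Unique (sym (trans (sym (map-∘ xs)) (map-id-local (All.tabulate round-trip)))) unique)
    listed⇒smooth : ∀ s → s ∈ map (toLabelling n) xs → SmoothArith n s
    listed⇒smooth s s∈ with ∈-map⁻ (toLabelling n) {xs = xs} s∈
    ... | x , x∈ , refl = subst Smooth (sym (round-trip x∈)) (proj₁ (All.lookup sound x∈))
    smooth⇒listed : ∀ s → SmoothArith n s → s ∈ map (toLabelling n) xs
    smooth⇒listed (a₁ , a₂ , b) smooth =
      subst (λ v → (a₁ , a₂ , v) ∈ map (toLabelling n) xs) (vecOf-toList b)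
            (∈-map⁺ (toLabelling n) (complete a₁ a₂ b smooth))

smooths-exactly : ∀ n → HasExactly n (length (smooths n))
smooths-exactly n = exactly n (smooths n) (smooths-unique n) (smooths-sound n) complete
  where
    complete : ∀ a₁ a₂ (b : Vec ℕ n) → Smooth (a₁ , a₂ , toList b) → (a₁ , a₂ , toList b) ∈ smooths n
    complete a₁ a₂ b smooth =
      subst (λ m → (a₁ , a₂ , toList b) ∈ smooths m) (length-toList b) (smooths-complete a₁ a₂ (toList b) smooth)

theorem4p2 : ((n : ℕ) → 4 ≤ n → HasExactly n (9 * n ∸ 11 + (n ∸ 3) / 4))
    × HasExactly 3 17 × HasExactly 2 8 × HasExactly 1 3
theorem4p2 = large , exact 3 refl , exact 2 refl , exact 1 refl
  where
    exact : ∀ n {c} → length (smooths n) ≡ c → HasExactly n c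
    exact n eq = subst (HasExactly n) eq (smooths-exactly n)
    formula : ∀ k → 9 * (4 + k) ≡ 11 + (25 + 9 * k)
    formula = solve-∀
    large : (n : ℕ) → 4 ≤ n → HasExactly n (9 * n ∸ 11 + (n ∸ 3) / 4)
    large _ (s≤s (s≤s (s≤s (s≤s {n = k} z≤n)))) =
      exact (4 + k) (trans (count k) (cong (λ m → m ∸ 11 + (1 + k) / 4) (sym (formula k))))
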